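{- Let $u,w$ be words of the same length $n$. Then $u\sim_{cd}w$ if and only if $u^{\star}\sim_{rd}w^{\star}$.
   Context: Words have positive integer letters. A 2-line array is a two-row array of positive integers whose columns are in lexicographic order from left to right (top entries taking precedence); the top row entries are indices, the bottom row entries values. For a 2-line array $A$, $A^{\star}$ is obtained by swapping the two rows and reordering the columns lexicographically. For a word $w\in\mathfrak{W}_n$, let $A$ be the 2-line array with indices $1,\dots,n$ and values $w_1,\dots,w_n$; $w^{\star}$ is the word formed by the values (bottom row) of $A^{\star}$. For a word $x$, $\mathrm{lds}(x)$ is the length of a longest strictly decreasing subsequence. $u\sim_{cd}w$ means $\mathrm{lds}(u_i\cdots u_j)=\mathrm{lds}(w_i\cdots w_j)$ for all $1\le i\le j\le n$. $u\sim_{rd}w$ means that for every integer interval $[a,b]$, the words obtained from $u$ and $w$ by deleting all letters not in $[a,b]$ have equal $\mathrm{lds}$. -}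

module Defs where

open import Data.Bool using (Bool; true; false; _∨_; _∧_)
open import Data.Nat using (ℕ; zero; suc; _≤_; _<_; _>_; _∸_; _⊔_; _≤?_; _>?_; _≡ᵇ_; _<ᵇ_)
open import Data.Product using (_×_; _,_; proj₁; proj₂)
open import Data.List using (List; []; _∷_; map; filter; length; take; drop; zip; upTo; foldr; _++_)
open import Data.List.Relation.Unary.All using (All)
open import Data.List.Relation.Unary.Linked using (Linked; linked?)
open import Relation.Nullary.Decidable using (_×-dec_)
open import Relation.Binary.PropositionalEquality using (_≡_)

IsWord : List ℕ → Set
IsWord w = All (λ x → 1 ≤ x) w

-- A 2-line array: list of columns (top , bottom).
TwoLine : Set
TwoLine = List (ℕ × ℕ)

lexLeq : ℕ × ℕ → ℕ × ℕ → Bool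
lexLeq (a , b) (c , d) = (a <ᵇ c) ∨ ((a ≡ᵇ c) ∧ ((b <ᵇ d) ∨ (b ≡ᵇ d)))

insertLex : ℕ × ℕ → TwoLine → TwoLine
insertLex p [] = p ∷ []
insertLex p (q ∷ qs) with lexLeq p q
... | true  = p ∷ q ∷ qs
... | false = q ∷ insertLex p qs

sortLex : TwoLine → TwoLine
sortLex = foldr insertLex []

swap : ℕ × ℕ → ℕ × ℕ
swap (a , b) = (b , a)

_⋆ᴬ : TwoLine → TwoLine
A ⋆ᴬ = sortLex (map swap A)

arrayOf : List ℕ → TwoLine
arrayOf w = zip (map suc (upTo (length w))) w

_⋆ : List ℕ → List ℕ
w ⋆ = map proj₂ (arrayOf w ⋆ᴬ)

subseqs : List ℕ → List (List ℕ)
subseqs [] = [] ∷ []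
subseqs (x ∷ xs) = map (x ∷_) (subseqs xs) ++ subseqs xs

lds : List ℕ → ℕ
lds x = foldr _⊔_ 0 (map length (filter (linked? _>?_) (subseqs x)))

-- the factor u_i ⋯ u_j (1-based, inclusive)
factor : ℕ → ℕ → List ℕ → List ℕ
factor i j u = drop (i ∸ 1) (take j u)

restrict : ℕ → ℕ → List ℕ → List ℕ
restrict a b = filter (λ x → (a ≤? x) ×-dec (x ≤? b))

CD : ℕ → List ℕ → List ℕ → Set
CD n u w = ∀ i j → 1 ≤ i → i ≤ j → j ≤ n → lds (factor i j u) ≡ lds (factor i j w)

RD : List ℕ → List ℕ → Set
RD u w = ∀ a b → lds (restrict a b u) ≡ lds (restrict a b w)

-- Number the letters of u as columns (i , uᵢ). The factor uₐ ⋯ u_b is the bottom row of the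
-- columns with index in [a , b]; restricting u⋆ to the letters in [a , b] leaves the bottom row
-- of exactly these columns with their entries swapped, sorted lexicographically. In either array a
-- strictly decreasing subsequence of the bottom row is a chain of inversions (lexicographically
-- increasing columns with decreasing bottom entries), and swapping the entries of every column
-- and reversing the chain turns inversion chains of one array into inversion chains of the other.
-- Hence lds (restrict a b (u ⋆)) = lds (uₐ ⋯ u_b) for all a and b; factors outside
-- 1 ≤ a ≤ b ≤ n are either clamped into that range or empty.
module Submission where

open import Defs
open import Level using (0ℓ)
open import Data.Bool using (true; false)
open import Data.Nat using (ℕ; zero; suc; s≤s; _+_; _≤_; _<_; _>_; _∸_; _⊔_; _⊓_; _≡ᵇ_)
open import Data.Nat.Properties
open import Data.Product using (_×_; _,_; proj₁; proj₂; ∃-syntax)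
open import Data.Product.Relation.Binary.Lex.Strict using (×-Lex; ×-isStrictTotalOrder)
open import Data.Product.Relation.Binary.Pointwise.NonDependent using (≡×≡⇒≡; ≡⇒≡×≡)
open import Data.Sum using (_⊎_; inj₁; inj₂; [_,_])
open import Data.Empty using (⊥-elim)
open import Data.List using (List; []; _∷_; map; filter; length; foldr; take; drop; zip; reverse; applyUpTo)
open import Data.List.Properties
  using (unfold-reverse; length-map; length-reverse; foldr-preservesᵒ; map-applyUpTo; filter-accept; filter-reject;
         take-[]; drop-[]; take-all; take-take; drop-all; length-take)
open import Data.List.Relation.Unary.All as All using (All; []; _∷_)
import Data.List.Relation.Unary.All.Properties as All
open import Data.List.Relation.Unary.Any as Any using (here; there)
open import Data.List.Relation.Unary.AllPairs as AllPairs using (AllPairs; []; _∷_)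
import Data.List.Relation.Unary.AllPairs.Properties as AllPairs
open import Data.List.Relation.Unary.Linked using (linked?)
open import Data.List.Relation.Unary.Linked.Properties using (Linked⇒AllPairs; AllPairs⇒Linked)
open import Data.List.Relation.Binary.Sublist.Propositional using (_⊆_; []; _∷_; _∷ʳ_; minimum)
open import Data.List.Relation.Binary.Sublist.Propositional.Properties as Sublist using (All-resp-⊆)
open import Data.List.Relation.Binary.Permutation.Propositional using (_↭_; ↭-refl; ↭-prep; ↭-swap; ↭-trans; ↭-sym)
open import Data.List.Relation.Binary.Permutation.Propositional.Properties using (All-resp-↭; ∈-resp-↭; ↭-reverse)
open import Data.List.Membership.Propositional using (_∈_)
open import Data.List.Membership.Propositional.Properties
  using (∈-map⁺; ∈-map⁻; ∈-++⁺ˡ; ∈-++⁺ʳ; ∈-++⁻; ∈-filter⁺; ∈-filter⁻; foldr-selective)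
open import Function using (_∘_; id; flip)
open import Function.Bundles using (_⇔_; mk⇔)
open import Relation.Binary using (Rel; Transitive; Irreflexive; tri<; tri≈; tri>; IsStrictTotalOrder)
open import Relation.Binary.PropositionalEquality using (_≡_; _≢_; refl; sym; trans; cong; cong₂; module ≡-Reasoning)
open import Relation.Unary using (Pred; Decidable)
open import Relation.Nullary using (¬_; yes; no)
open import Relation.Nullary.Decidable using (_×-dec_)
open import Relation.Nullary.Reflects using (Reflects; ofʸ; ofⁿ; fromEquivalence; det; _⊎-reflects_; _×-reflects_)

module _ {A : Set} {R : A → A → Set} where

  AllPairs-resp-⊆ : ∀ {xs ys} → xs ⊆ ys → AllPairs R ys → AllPairs R xs
  AllPairs-resp-⊆ [] [] = []
  AllPairs-resp-⊆ (y ∷ʳ xs⊆ys) (_ ∷ Rys) = AllPairs-resp-⊆ xs⊆ys Rys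
  AllPairs-resp-⊆ (refl ∷ xs⊆ys) (Ry ∷ Rys) = All-resp-⊆ xs⊆ys Ry ∷ AllPairs-resp-⊆ xs⊆ys Rys

  AllPairs-reverse : ∀ {xs} → AllPairs R xs → AllPairs (flip R) (reverse xs)
  AllPairs-reverse [] = []
  AllPairs-reverse {x ∷ xs} (Rx ∷ Rxs) rewrite unfold-reverse x xs =
    AllPairs.++⁺ (AllPairs-reverse Rxs) ([] ∷ []) (All.map (_∷ []) (All-resp-↭ (↭-sym (↭-reverse xs)) Rx))

filter-map : ∀ {A B : Set} {P : Pred B 0ℓ} (P? : Decidable P) (f : A → B) xs →
  filter P? (map f xs) ≡ map f (filter (P? ∘ f) xs)
filter-map P? f [] = refl
filter-map P? f (x ∷ xs) with P? (f x)
... | yes _ = cong (f x ∷_) (filter-map P? f xs)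
... | no _ = filter-map P? f xs

module _ {A : Set} {_<_ : A → A → Set} (<-trans : Transitive _<_) (<-irrefl : Irreflexive _≡_ _<_) where

  private
    ∈-tail : ∀ {y ys zs} → All (_∈ y ∷ ys) zs → All (y <_) zs → All (_∈ ys) zs
    ∈-tail [] [] = []
    ∈-tail (here z≡y ∷ _) (y<z ∷ _) = ⊥-elim (<-irrefl (sym z≡y) y<z)
    ∈-tail (there z∈ys ∷ zs∈) (_ ∷ y<zs) = z∈ys ∷ ∈-tail zs∈ y<zs

  sorted-⊆ : ∀ {xs ys} → AllPairs _<_ xs → AllPairs _<_ ys → All (_∈ ys) xs → xs ⊆ ys
  sorted-⊆ {[]} {ys} _ _ _ = minimum ys
  sorted-⊆ {x ∷ xs} {y ∷ ys} (x<xs ∷ xs<) (y<ys ∷ ys<) (here refl ∷ xs∈) =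
    refl ∷ sorted-⊆ xs< ys< (∈-tail xs∈ x<xs)
  sorted-⊆ {x ∷ xs} {y ∷ ys} (x<xs ∷ xs<) (y<ys ∷ ys<) (there x∈ys ∷ xs∈) =
    y ∷ʳ sorted-⊆ (x<xs ∷ xs<) ys< (x∈ys ∷ ∈-tail xs∈ (All.map (<-trans y<x) x<xs))
    where y<x = All.lookup y<ys x∈ys

⊆-map-preimage : ∀ {A B : Set} (f : A → B) {s} xs → s ⊆ map f xs → ∃[ ys ] ys ⊆ xs × map f ys ≡ s
⊆-map-preimage f [] [] = [] , [] , refl
⊆-map-preimage f (x ∷ xs) (_ ∷ʳ s⊆) with ⊆-map-preimage f xs s⊆
... | ys , ys⊆xs , refl = ys , x ∷ʳ ys⊆xs , refl
⊆-map-preimage f (x ∷ xs) (refl ∷ s⊆) with ⊆-map-preimage f xs s⊆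
... | ys , ys⊆xs , refl = x ∷ ys , refl ∷ ys⊆xs , refl

∈-subseqs⁺ : ∀ {s x} → s ⊆ x → s ∈ subseqs x
∈-subseqs⁺ [] = here refl
∈-subseqs⁺ {x = y ∷ x} (y ∷ʳ s⊆x) = ∈-++⁺ʳ (map (y ∷_) (subseqs x)) (∈-subseqs⁺ s⊆x)
∈-subseqs⁺ {x = y ∷ x} (refl ∷ s⊆x) = ∈-++⁺ˡ (∈-map⁺ (y ∷_) (∈-subseqs⁺ s⊆x))

∈-subseqs⁻ : ∀ x {s} → s ∈ subseqs x → s ⊆ x
∈-subseqs⁻ [] (here refl) = []
∈-subseqs⁻ (y ∷ x) s∈ with ∈-++⁻ (map (y ∷_) (subseqs x)) s∈
... | inj₂ s∈′ = y ∷ʳ ∈-subseqs⁻ x s∈′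
... | inj₁ s∈′ with ∈-map⁻ (y ∷_) s∈′
... | _ , s∈″ , refl = refl ∷ ∈-subseqs⁻ x s∈″

≤-max : ∀ {m} ns → m ∈ ns → m ≤ foldr _⊔_ 0 ns
≤-max ns m∈ns =
  foldr-preservesᵒ (λ x y → [ m≤n⇒m≤n⊔o y , m≤n⇒m≤o⊔n x ]) 0 ns (inj₂ (Any.map ≤-reflexive m∈ns))

length≤lds : ∀ {s x} → s ⊆ x → AllPairs _>_ s → length s ≤ lds x
length≤lds s⊆x s↓ =
  ≤-max _ (∈-map⁺ length (∈-filter⁺ (linked? _>?_) (∈-subseqs⁺ s⊆x) (AllPairs⇒Linked s↓)))

lds-attained : ∀ x → ∃[ s ] s ⊆ x × AllPairs _>_ s × length s ≡ lds x
lds-attained x with foldr-selective ⊔-sel 0 (map length (filter (linked? _>?_) (subseqs x)))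
... | inj₁ lds≡0 = [] , minimum x , [] , sym lds≡0
... | inj₂ lds∈ with ∈-map⁻ length lds∈
... | s , s∈ , lds≡|s| with ∈-filter⁻ (linked? _>?_) {xs = subseqs x} s∈
... | s∈′ , s↓ = s , ∈-subseqs⁻ x s∈′ , Linked⇒AllPairs (λ y<x z<y → <-trans z<y y<x) s↓ , sym lds≡|s|

_<ₗₑₓ_ : Rel (ℕ × ℕ) 0ℓ
_<ₗₑₓ_ = ×-Lex _≡_ _<_ _<_

private
  module Lex = IsStrictTotalOrder (×-isStrictTotalOrder <-isStrictTotalOrder <-isStrictTotalOrder)

<ₗₑₓ-trans : Transitive _<ₗₑₓ_
<ₗₑₓ-trans = Lex.trans

<ₗₑₓ-irrefl : Irreflexive _≡_ _<ₗₑₓ_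
<ₗₑₓ-irrefl = Lex.irrefl ∘ ≡⇒≡×≡

<ₗₑₓ-asym : ∀ {p q} → p <ₗₑₓ q → ¬ q <ₗₑₓ p
<ₗₑₓ-asym p<q q<p = <ₗₑₓ-irrefl refl (<ₗₑₓ-trans p<q q<p)

≡ᵇ-reflects-≡ : ∀ m n → Reflects (m ≡ n) (m ≡ᵇ n)
≡ᵇ-reflects-≡ m n = fromEquivalence (≡ᵇ⇒≡ m n) (≡⇒≡ᵇ m n)

lexLeq-reflects : ∀ a b c d →
  Reflects (a < c ⊎ (a ≡ c × (b < d ⊎ b ≡ d))) (lexLeq (a , b) (c , d))
lexLeq-reflects a b c d =
  <ᵇ-reflects-< a c ⊎-reflects
  (≡ᵇ-reflects-≡ a c ×-reflects (<ᵇ-reflects-< b d ⊎-reflects ≡ᵇ-reflects-≡ b d))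

lexLeq-< : ∀ {p q} → p <ₗₑₓ q → lexLeq p q ≡ true
lexLeq-< {a , b} {c , d} (inj₁ a<c) = det (lexLeq-reflects a b c d) (ofʸ (inj₁ a<c))
lexLeq-< {a , b} {c , d} (inj₂ (a≡c , b<d)) = det (lexLeq-reflects a b c d) (ofʸ (inj₂ (a≡c , inj₁ b<d)))

lexLeq-> : ∀ {p q} → q <ₗₑₓ p → lexLeq p q ≡ false
lexLeq-> {a , b} {c , d} q<p = det (lexLeq-reflects a b c d) (ofⁿ p≤q⇒q≮p)
  where
  p≤q⇒q≮p : ¬ (a < c ⊎ (a ≡ c × (b < d ⊎ b ≡ d)))
  p≤q⇒q≮p (inj₁ a<c) = <ₗₑₓ-asym (inj₁ a<c) q<p
  p≤q⇒q≮p (inj₂ (a≡c , inj₁ b<d)) = <ₗₑₓ-asym (inj₂ (a≡c , b<d)) q<p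
  p≤q⇒q≮p (inj₂ (refl , inj₂ refl)) = <ₗₑₓ-irrefl refl q<p

insertLex-↭ : ∀ p qs → insertLex p qs ↭ p ∷ qs
insertLex-↭ p [] = ↭-refl
insertLex-↭ p (q ∷ qs) with lexLeq p q
... | true = ↭-refl
... | false = ↭-trans (↭-prep q (insertLex-↭ p qs)) (↭-swap q p ↭-refl)

sortLex-↭ : ∀ ps → sortLex ps ↭ ps
sortLex-↭ [] = ↭-refl
sortLex-↭ (p ∷ ps) = ↭-trans (insertLex-↭ p (sortLex ps)) (↭-prep p (sortLex-↭ ps))

insertLex-sorted : ∀ {p qs} → All (p ≢_) qs → AllPairs _<ₗₑₓ_ qs → AllPairs _<ₗₑₓ_ (insertLex p qs)
insertLex-sorted {p} {[]} [] [] = [] ∷ []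
insertLex-sorted {p} {q ∷ qs} (p≢q ∷ p≢qs) (q<qs ∷ qs-sorted) with Lex.compare p q
... | tri< p<q _ _ rewrite lexLeq-< p<q =
  (p<q ∷ All.map (<ₗₑₓ-trans p<q) q<qs) ∷ q<qs ∷ qs-sorted
... | tri≈ _ p≈q _ = ⊥-elim (p≢q (≡×≡⇒≡ p≈q))
... | tri> _ _ q<p rewrite lexLeq-> q<p =
  All-resp-↭ (↭-sym (insertLex-↭ p qs)) (q<p ∷ q<qs) ∷ insertLex-sorted p≢qs qs-sorted

sortLex-sorted : ∀ {ps} → AllPairs _≢_ ps → AllPairs _<ₗₑₓ_ (sortLex ps)
sortLex-sorted [] = []
sortLex-sorted {p ∷ ps} (p≢ps ∷ ps-distinct) =
  insertLex-sorted (All-resp-↭ (↭-sym (sortLex-↭ ps)) p≢ps) (sortLex-sorted ps-distinct)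

swap-involutive : ∀ p → swap (swap p) ≡ p
swap-involutive (a , b) = refl

swap-injective : ∀ {p q} → swap p ≡ swap q → p ≡ q
swap-injective {a , b} {c , d} refl = refl

<ₗₑₓ⇒swap-≢ : ∀ {p q} → p <ₗₑₓ q → swap p ≢ swap q
<ₗₑₓ⇒swap-≢ p<q swap-p≡swap-q = <ₗₑₓ-irrefl (swap-injective swap-p≡swap-q) p<q

∈-sortLex-swap⁻ : ∀ {p cs} → p ∈ sortLex (map swap cs) → swap p ∈ cs
∈-sortLex-swap⁻ {p} {cs} p∈ with ∈-map⁻ swap (∈-resp-↭ (sortLex-↭ (map swap cs)) p∈)
... | c , c∈cs , refl rewrite swap-involutive c = c∈cs

∈-sortLex-swap⁺ : ∀ {c cs} → c ∈ cs → swap c ∈ sortLex (map swap cs)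
∈-sortLex-swap⁺ {c} {cs} c∈cs = ∈-resp-↭ (↭-sym (sortLex-↭ (map swap cs))) (∈-map⁺ swap c∈cs)

bottom : TwoLine → List ℕ
bottom = map proj₂

Inversion : ℕ × ℕ → ℕ × ℕ → Set
Inversion p q = p <ₗₑₓ q × proj₂ q < proj₂ p

Inversion-swap : ∀ {p q} → Inversion p q → Inversion (swap q) (swap p)
Inversion-swap (inj₁ a<c , d<b) = inj₁ d<b , a<c
Inversion-swap (inj₂ (refl , b<d) , d<b) = ⊥-elim (<-asym b<d d<b)

-- Swapped and reversed, an inversion chain of X is a lexicographically sorted list of columns of Y,
-- hence a sublist of Y.
lds-bottom-≤ : ∀ {X Y} → AllPairs _<ₗₑₓ_ X → AllPairs _<ₗₑₓ_ Y → (∀ {x} → x ∈ X → swap x ∈ Y) →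
  lds (bottom X) ≤ lds (bottom Y)
lds-bottom-≤ {X} {Y} X-sorted Y-sorted swap-X∈Y with lds-attained (bottom X)
... | s , s⊆ , s↓ , |s|≡lds with ⊆-map-preimage proj₂ X s⊆
... | S , S⊆X , refl = begin
  lds (bottom X)     ≡⟨ sym |s|≡lds ⟩
  length (bottom S)  ≡⟨ trans (length-map proj₂ S) (sym (length-map swap S)) ⟩
  length (map swap S) ≡⟨ sym (trans (length-map proj₂ T) (length-reverse (map swap S))) ⟩
  length (bottom T)  ≤⟨ length≤lds (Sublist.map⁺ proj₂ T⊆Y) (AllPairs.map⁺ (AllPairs.map proj₂ T-inv)) ⟩
  lds (bottom Y)     ∎
  where
  open ≤-Reasoning
  T = reverse (map swap S)
  S-inv : AllPairs Inversion S
  S-inv = AllPairs.zip (AllPairs-resp-⊆ S⊆X X-sorted , AllPairs.map⁻ s↓)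
  T-inv : AllPairs Inversion T
  T-inv = AllPairs-reverse (AllPairs.map⁺ (AllPairs.map Inversion-swap S-inv))
  T∈Y : All (_∈ Y) T
  T∈Y = All-resp-↭ (↭-sym (↭-reverse _)) (All.map⁺ (All-resp-⊆ S⊆X (All.tabulate swap-X∈Y)))
  T⊆Y : T ⊆ Y
  T⊆Y = sorted-⊆ <ₗₑₓ-trans <ₗₑₓ-irrefl (AllPairs.map proj₁ T-inv) Y-sorted T∈Y

lds-bottom-swap : ∀ {X Y} → AllPairs _<ₗₑₓ_ X → AllPairs _<ₗₑₓ_ Y →
  (∀ {x} → x ∈ X → swap x ∈ Y) → (∀ {y} → y ∈ Y → swap y ∈ X) → lds (bottom X) ≡ lds (bottom Y)
lds-bottom-swap X-sorted Y-sorted swap-X∈Y swap-Y∈X =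
  ≤-antisym (lds-bottom-≤ X-sorted Y-sorted swap-X∈Y) (lds-bottom-≤ Y-sorted X-sorted swap-Y∈X)

numberFrom : ℕ → List ℕ → TwoLine
numberFrom k [] = []
numberFrom k (x ∷ xs) = (k , x) ∷ numberFrom (suc k) xs

zip-applyUpTo : ∀ {f : ℕ → ℕ} {k} xs → (∀ i → f i ≡ k + i) →
  zip (applyUpTo f (length xs)) xs ≡ numberFrom k xs
zip-applyUpTo [] _ = refl
zip-applyUpTo {f} {k} (x ∷ xs) f≗k+ =
  cong₂ (λ i cs → (i , x) ∷ cs) (trans (f≗k+ 0) (+-identityʳ k))
        (zip-applyUpTo xs (λ i → trans (f≗k+ (suc i)) (+-suc k i)))

arrayOf≡numberFrom : ∀ u → arrayOf u ≡ numberFrom 1 u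
arrayOf≡numberFrom u =
  trans (cong (λ is → zip is u) (map-applyUpTo id suc (length u))) (zip-applyUpTo u (λ _ → refl))

numberFrom-index> : ∀ {k k′} xs → k < k′ → All (λ c → k < proj₁ c) (numberFrom k′ xs)
numberFrom-index> [] _ = []
numberFrom-index> (x ∷ xs) k<k′ = k<k′ ∷ numberFrom-index> xs (m<n⇒m<1+n k<k′)

numberFrom-sorted : ∀ k xs → AllPairs _<ₗₑₓ_ (numberFrom k xs)
numberFrom-sorted k [] = []
numberFrom-sorted k (x ∷ xs) =
  All.map inj₁ (numberFrom-index> xs ≤-refl) ∷ numberFrom-sorted (suc k) xs

filter-index≤ : ∀ b k u →
  filter ((_≤? b) ∘ proj₁) (numberFrom k u) ≡ numberFrom k (take (suc b ∸ k) u)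
filter-index≤ b k [] = cong (numberFrom k) (sym (take-[] (suc b ∸ k)))
filter-index≤ b k (x ∷ xs) with k ≤? b
... | yes k≤b rewrite +-∸-assoc 1 k≤b =
  trans (filter-accept ((_≤? b) ∘ proj₁) k≤b) (cong ((k , x) ∷_) (filter-index≤ b (suc k) xs))
... | no k≰b rewrite m≤n⇒m∸n≡0 (≰⇒> k≰b) = begin
  filter ((_≤? b) ∘ proj₁) ((k , x) ∷ numberFrom (suc k) xs)
    ≡⟨ filter-reject ((_≤? b) ∘ proj₁) k≰b ⟩
  filter ((_≤? b) ∘ proj₁) (numberFrom (suc k) xs)
    ≡⟨ filter-index≤ b (suc k) xs ⟩
  numberFrom (suc k) (take (b ∸ k) xs)
    ≡⟨ cong (λ n → numberFrom (suc k) (take n xs)) (m≤n⇒m∸n≡0 (<⇒≤ (≰⇒> k≰b))) ⟩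
  [] ∎
  where open ≡-Reasoning

bottom-filter-index≥ : ∀ a k u →
  bottom (filter ((a ≤?_) ∘ proj₁) (numberFrom k u)) ≡ drop (a ∸ k) u
bottom-filter-index≥ a k [] = sym (drop-[] (a ∸ k))
bottom-filter-index≥ a k (x ∷ xs) with a ≤? k
... | yes a≤k rewrite filter-accept ((a ≤?_) ∘ proj₁) {k , x} {numberFrom (suc k) xs} a≤k
                    | m≤n⇒m∸n≡0 a≤k | bottom-filter-index≥ a (suc k) xs | m≤n⇒m∸n≡0 (m≤n⇒m≤1+n a≤k) = refl
... | no a≰k rewrite filter-reject ((a ≤?_) ∘ proj₁) {k , x} {numberFrom (suc k) xs} a≰k
                   | +-∸-assoc 1 (≰⇒> a≰k) = bottom-filter-index≥ a (suc k) xs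

bottom-index-range : ∀ a b u →
  bottom (filter ((a ≤?_) ∘ proj₁) (filter ((_≤? b) ∘ proj₁) (numberFrom 1 u))) ≡ factor a b u
bottom-index-range a b u rewrite filter-index≤ b 1 u = bottom-filter-index≥ a 1 (take b u)

inRange? : ∀ a b → Decidable (λ x → a ≤ x × x ≤ b)
inRange? a b x = (a ≤? x) ×-dec (x ≤? b)

lds-restrict-⋆ : ∀ u a b → lds (restrict a b (u ⋆)) ≡ lds (factor a b u)
lds-restrict-⋆ u a b = begin
  lds (restrict a b (u ⋆))
    ≡⟨ cong (lds ∘ restrict a b ∘ bottom ∘ sortLex ∘ map swap) (arrayOf≡numberFrom u) ⟩
  lds (restrict a b (bottom B)) ≡⟨ cong lds (filter-map (inRange? a b) proj₂ B) ⟩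
  lds (bottom X)                ≡⟨ lds-bottom-swap X-sorted Y-sorted swap-X∈Y swap-Y∈X ⟩
  lds (bottom Y)                ≡⟨ cong lds (bottom-index-range a b u) ⟩
  lds (factor a b u)            ∎
  where
  open ≡-Reasoning
  A = numberFrom 1 u
  B = sortLex (map swap A)
  X = filter (inRange? a b ∘ proj₂) B
  Y = filter ((a ≤?_) ∘ proj₁) (filter ((_≤? b) ∘ proj₁) A)
  A-sorted = numberFrom-sorted 1 u
  X-sorted : AllPairs _<ₗₑₓ_ X
  X-sorted = AllPairs.filter⁺ _ (sortLex-sorted (AllPairs.map⁺ (AllPairs.map <ₗₑₓ⇒swap-≢ A-sorted)))
  Y-sorted : AllPairs _<ₗₑₓ_ Y
  Y-sorted = AllPairs.filter⁺ _ (AllPairs.filter⁺ _ A-sorted)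
  swap-X∈Y : ∀ {x} → x ∈ X → swap x ∈ Y
  swap-X∈Y x∈X with ∈-filter⁻ (inRange? a b ∘ proj₂) {xs = B} x∈X
  ... | x∈B , a≤ , ≤b =
    ∈-filter⁺ ((a ≤?_) ∘ proj₁) (∈-filter⁺ ((_≤? b) ∘ proj₁) (∈-sortLex-swap⁻ {cs = A} x∈B) ≤b) a≤
  swap-Y∈X : ∀ {y} → y ∈ Y → swap y ∈ X
  swap-Y∈X y∈Y with ∈-filter⁻ ((a ≤?_) ∘ proj₁) y∈Y
  ... | y∈′ , a≤ with ∈-filter⁻ ((_≤? b) ∘ proj₁) {xs = A} y∈′
  ... | y∈A , ≤b = ∈-filter⁺ (inRange? a b ∘ proj₂) (∈-sortLex-swap⁺ y∈A) (a≤ , ≤b)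

factor-clamp : ∀ a b u → factor a b u ≡ factor (a ⊔ 1) (b ⊓ length u) u
factor-clamp a b u = cong₂ drop (pred≡pred-⊔1 a) take-clamp
  where
  pred≡pred-⊔1 : ∀ a → a ∸ 1 ≡ (a ⊔ 1) ∸ 1
  pred≡pred-⊔1 zero = refl
  pred≡pred-⊔1 (suc a) = sym (⊔-identityʳ a)
  take-clamp : take b u ≡ take (b ⊓ length u) u
  take-clamp = trans (cong (take b) (sym (take-all (length u) u ≤-refl))) (take-take b (length u) u)

factor-empty : ∀ {i j} u → j < i → factor i j u ≡ []
factor-empty {suc i} {j} u (s≤s j≤i) = drop-all i (take j u) (begin
  length (take j u) ≡⟨ length-take j u ⟩
  j ⊓ length u      ≤⟨ m⊓n≤m j (length u) ⟩
  j                 ≤⟨ j≤i ⟩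
  i                 ∎)
  where open ≤-Reasoning

CD⇒lds-factor : ∀ {n u w} → length u ≡ n → length w ≡ n → CD n u w →
  ∀ a b → lds (factor a b u) ≡ lds (factor a b w)
CD⇒lds-factor {u = u} {w} refl |w|≡n cd a b
  rewrite factor-clamp a b u | factor-clamp a b w | |w|≡n with (a ⊔ 1) ≤? (b ⊓ length u)
... | yes i≤j = cd (a ⊔ 1) (b ⊓ length u) (m≤n⊔m a 1) i≤j (m⊓n≤n b (length u))
... | no i≰j rewrite factor-empty u (≰⇒> i≰j) | factor-empty w (≰⇒> i≰j) = refl

lemma4p15 : (n : ℕ) (u w : List ℕ) → IsWord u → IsWord w →
    length u ≡ n → length w ≡ n → (CD n u w ⇔ RD (u ⋆) (w ⋆))
-- The letters need not be positive.
lemma4p15 n u w _ _ |u|≡n |w|≡n = mk⇔ CD⇒RD RD⇒CD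
  where
  open ≡-Reasoning
  CD⇒RD : CD n u w → RD (u ⋆) (w ⋆)
  CD⇒RD cd a b = begin
    lds (restrict a b (u ⋆)) ≡⟨ lds-restrict-⋆ u a b ⟩
    lds (factor a b u)       ≡⟨ CD⇒lds-factor |u|≡n |w|≡n cd a b ⟩
    lds (factor a b w)       ≡⟨ lds-restrict-⋆ w a b ⟨
    lds (restrict a b (w ⋆)) ∎
  RD⇒CD : RD (u ⋆) (w ⋆) → CD n u w
  RD⇒CD rd i j _ _ _ = begin
    lds (factor i j u)       ≡⟨ lds-restrict-⋆ u i j ⟨
    lds (restrict i j (u ⋆)) ≡⟨ rd i j ⟩
    lds (restrict i j (w ⋆)) ≡⟨ lds-restrict-⋆ w i j ⟩
    lds (factor i j w)       ∎
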